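{- Let $b$ be a positive integer. The following games have the stated horizontal preperiod and horizontal period: (i) $L(b;1,0;1,b-1)$ with $b$ odd: preperiod $b-1$, period $2$; (ii) $L(b;1,0;1,b-1)$ with $b$ even: preperiod $b-2$, period $4b$; (iii) $L(b;1,0;1,b+1)$ with $b$ odd: preperiod $b-1$, period $2$; (iv) $L(b;1,0;1,b+1)$ with $b$ even: preperiod $b-2$, period $4b$.
   Context: The Lengyel transfer game $L(b;x_1,y_1;x_2,y_2)$ is the impartial normal-play game on positions $(x,y)\in\mathbb{N}^2$ in which a move consists of adding one of $(0,-b)$, $(-x_1,y_1)$, $(-x_2,y_2)$, provided the result lies in $\mathbb{N}^2$; $\mathcal{SG}(x,y)$ is the Sprague–Grundy value. The horizontal period is the least positive integer $p$ such that for some $x_0$, $\mathcal{SG}(x+p,y)=\mathcal{SG}(x,y)$ for all $x\ge x_0$ and all $y$; the horizontal preperiod is the least such $x_0$ (for this $p$). -}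

module Defs where

open import Data.Nat using (ℕ; zero; suc; _+_; _*_; _∸_; _≤_; _<_; _≤ᵇ_; _≡ᵇ_)
open import Data.Bool using (Bool; true; false; if_then_else_)
open import Data.List using (List; []; _∷_; _++_; map; length)
open import Data.Bool.ListAction using (any)
open import Data.Product using (_×_; _,_; ∃)
open import Relation.Binary.PropositionalEquality using (_≡_)

Pos : Set
Pos = ℕ × ℕ

record Params : Set where
  constructor L
  field
    b x₁ y₁ x₂ y₂ : ℕ
open Params public

-- Options of (x , y): add (0,-b), (-x₁,y₁), (-x₂,y₂) whenever the result lies in ℕ².
options : Params → Pos → List Pos
options P (x , y) =
  (if b P ≤ᵇ y then (x , y ∸ b P) ∷ [] else [])
  ++ (if x₁ P ≤ᵇ x then (x ∸ x₁ P , y + y₁ P) ∷ [] else [])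
  ++ (if x₂ P ≤ᵇ x then (x ∸ x₂ P , y + y₂ P) ∷ [] else [])

-- Minimum excludant: the least natural number not occurring in the list.
-- (It is at most the length of the list, so searching length+1 candidates suffices.)
mex : List ℕ → ℕ
mex l = search (length l) 0
  where
  search : ℕ → ℕ → ℕ
  search zero n = n
  search (suc k) n = if any (n ≡ᵇ_) l then search k (suc n) else n

sgFuel : Params → ℕ → Pos → ℕ
sgFuel P zero p = 0
sgFuel P (suc k) p = mex (mapOpts (options P p))
  where
  mapOpts : List Pos → List ℕ
  mapOpts [] = []
  mapOpts (q ∷ qs) = sgFuel P k q ∷ mapOpts qs

-- A bound strictly exceeding the length of any play from (x , y) whenever b, x₁, x₂ ≥ 1:
-- at most x moves of the second/third kind, and at most y + x*(y₁+y₂) moves of the first kind.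
fuelBound : Params → Pos → ℕ
fuelBound P (x , y) = suc (x + (y + x * (y₁ P + y₂ P)))

-- The Sprague–Grundy function SG(x , y) of L(b;x₁,y₁;x₂,y₂)
-- (correct whenever b, x₁, x₂ ≥ 1, which is the case in all uses below).
SG : Params → ℕ → ℕ → ℕ
SG P x y = sgFuel P (fuelBound P (x , y)) (x , y)

HPeriodicFrom : (ℕ → ℕ → ℕ) → ℕ → ℕ → Set
HPeriodicFrom g p x₀ = ∀ x y → x₀ ≤ x → g (x + p) y ≡ g x y

HPreperiodAndPeriod : (ℕ → ℕ → ℕ) → ℕ → ℕ → Set
HPreperiodAndPeriod g x₀ p =
  (0 < p)
  × HPeriodicFrom g p x₀
  × (∀ p′ x₀′ → 0 < p′ → HPeriodicFrom g p′ x₀′ → p ≤ p′)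
  × (∀ x₀′ → HPeriodicFrom g p x₀′ → x₀ ≤ x₀′)

{-# OPTIONS --safe #-}

-- In L(b;1,0;1,c) column x only sees columns x and x - 1, and going up b rows flips the last bit
-- of the value: SG(x, qb + r) is row x r xor (q mod 2), where row is a cellular automaton on b
-- cells with values in {0,1,2,3}.  Row 0 is zero and row (x+1) r = mex {row x r, n r}, where
-- n (r+1) = row x r xor 1 and n 0 = row x (b-1); for c = b + 1 the same automaton appears with the
-- cells read backwards.  So the horizontal periods of SG are the row periods of the automaton.
-- Rows 0, ..., b are explicit: a checkerboard left of the diagonal, 0 or 2 on and right of it.
-- For b odd every row from b - 1 on is the checkerboard parity (x + r).  For b even, rows from b on
-- are checkerboards in which each cell is in phase, out of phase, or 2: a front of out-of-phase
-- cells led by a 2 sweeps through the row in 2b steps, leaving the inverted checkerboard, and a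
-- second sweep restores it, which gives row (x + 4b) = row x from x = b - 2 on.  Minimality of the
-- period and of the preperiod is read off from the cells holding a 2.

module Submission where

open import Data.Bool using (Bool; true; false; T; if_then_else_)
open import Data.Bool.Properties using (T-≡; ¬-not)
open import Data.Empty using (⊥; ⊥-elim)
open import Data.List using ([]; _∷_; map)
open import Data.List.Properties using (map-cong-local)
open import Data.List.Relation.Unary.All as All using (All; []; _∷_)
open import Data.List.Relation.Unary.All.Properties using (++⁺)
open import Data.Nat using (ℕ; zero; suc; _+_; _*_; _∸_; _≤_; _<_; _%_; _/_; z≤n; s≤s; _≤ᵇ_; _<ᵇ_; parity; >-nonZero)
open import Data.Nat.DivMod using (m≡m%n+[m/n]*n; m%n<n)
open import Data.Nat.Properties
open import Data.Nat.Tactic.RingSolver using (solve-∀)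
open import Data.Parity.Base as ℙ using (Parity; 0ℙ; 1ℙ; _⁻¹)
open import Data.Parity.Properties as ℙ using (+-homo-+; p+p≡0ℙ; ⁻¹-selfInverse)
open import Data.Product using (_×_; _,_; proj₁; proj₂; uncurry)
open import Data.Sum as Sum using (_⊎_; inj₁; inj₂)
open import Data.Unit using (⊤; tt)
open import Function.Base using (_∘_)
open import Function.Bundles using (Equivalence; _⇔_; mk⇔)
open import Relation.Binary.Definitions using (tri<; tri≈; tri>)
open import Relation.Binary.PropositionalEquality using (_≡_; _≢_; refl; sym; trans; cong; cong₂; subst; module ≡-Reasoning)
open import Relation.Nullary using (¬_; yes; no; contradiction)

open import Defs

-- Sprague–Grundy values via the recursion on options

All-if-singleton : ∀ {A : Set} {Q : A → Set} (t : Bool) {a : A} → (T t → Q a) → All Q (if t then a ∷ [] else [])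
All-if-singleton true  q = q tt ∷ []
All-if-singleton false q = []

module _ (P : Params) where

  fuelBound-vertical-< : ∀ {x y} → 1 ≤ b P → b P ≤ y → fuelBound P (x , y ∸ b P) < fuelBound P (x , y)
  fuelBound-vertical-< {x} 1≤b b≤y = s≤s (+-monoʳ-< x (+-monoˡ-< (x * _) (∸-monoʳ-< 1≤b b≤y)))

  fuelBound-transfer-< : ∀ {m x y t} → m < x → t ≤ y₁ P + y₂ P → fuelBound P (m , y + t) < fuelBound P (x , y)
  fuelBound-transfer-< {m} {x} {y} {t} m<x t≤s = s≤s (begin-strict
    m + (y + t + m * s)      ≤⟨ +-monoʳ-≤ m (+-monoˡ-≤ (m * s) (+-monoʳ-≤ y t≤s)) ⟩
    m + (y + s + m * s)      ≡⟨ cong (m +_) (+-assoc y s (m * s)) ⟩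
    m + (y + suc m * s)      <⟨ n<1+n _ ⟩
    suc m + (y + suc m * s)  ≤⟨ +-mono-≤ m<x (+-monoʳ-≤ y (*-monoˡ-≤ s m<x)) ⟩
    x + (y + x * s)          ∎)
    where
    open ≤-Reasoning
    s = y₁ P + y₂ P

  fuelBound-options : 1 ≤ b P → 1 ≤ x₁ P → 1 ≤ x₂ P →
                      ∀ p → All (λ q → fuelBound P q < fuelBound P p) (options P p)
  fuelBound-options 1≤b 1≤x₁ 1≤x₂ (x , y) =
    ++⁺ (All-if-singleton (b P ≤ᵇ y) λ t → fuelBound-vertical-< {x} 1≤b (≤ᵇ⇒≤ _ _ t))
        (++⁺ (All-if-singleton (x₁ P ≤ᵇ x) λ t →
                fuelBound-transfer-< (∸-monoʳ-< 1≤x₁ (≤ᵇ⇒≤ _ _ t)) (m≤m+n _ _))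
             (All-if-singleton (x₂ P ≤ᵇ x) λ t →
                fuelBound-transfer-< (∸-monoʳ-< 1≤x₂ (≤ᵇ⇒≤ _ _ t)) (m≤n+m _ _)))

  sgFuel-suc : ∀ k p → sgFuel P (suc k) p ≡ mex (map (sgFuel P k) (options P p))
  sgFuel-suc k (x , y) with b P ≤ᵇ y | x₁ P ≤ᵇ x | x₂ P ≤ᵇ x
  ... | true  | true  | true  = refl
  ... | true  | true  | false = refl
  ... | true  | false | true  = refl
  ... | true  | false | false = refl
  ... | false | true  | true  = refl
  ... | false | true  | false = refl
  ... | false | false | true  = refl
  ... | false | false | false = refl

  module _ (1≤b : 1 ≤ b P) (1≤x₁ : 1 ≤ x₁ P) (1≤x₂ : 1 ≤ x₂ P) where

    private
      options-< : ∀ p → All (λ q → fuelBound P q < fuelBound P p) (options P p)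
      options-< = fuelBound-options 1≤b 1≤x₁ 1≤x₂

    sgFuel-stable : ∀ k k′ p → fuelBound P p ≤ k → fuelBound P p ≤ k′ → sgFuel P k p ≡ sgFuel P k′ p
    sgFuel-stable (suc k) (suc k′) p f≤k f≤k′ = begin
      sgFuel P (suc k) p                     ≡⟨ sgFuel-suc k p ⟩
      mex (map (sgFuel P k) (options P p))   ≡⟨ cong mex (map-cong-local (All.map stable (options-< p))) ⟩
      mex (map (sgFuel P k′) (options P p))  ≡⟨ sgFuel-suc k′ p ⟨
      sgFuel P (suc k′) p                    ∎
      where
      open ≡-Reasoning
      stable : ∀ {q} → fuelBound P q < fuelBound P p → sgFuel P k q ≡ sgFuel P k′ q
      stable {q} f<f = sgFuel-stable k k′ q (≤-pred (≤-trans f<f f≤k)) (≤-pred (≤-trans f<f f≤k′))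

    SG-rec : ∀ x y → SG P x y ≡ mex (map (uncurry (SG P)) (options P (x , y)))
    SG-rec x y = begin
      SG P x y                                        ≡⟨ sgFuel-suc k (x , y) ⟩
      mex (map (sgFuel P k) (options P (x , y)))      ≡⟨ cong mex (map-cong-local (All.map stable (options-< (x , y)))) ⟩
      mex (map (uncurry (SG P)) (options P (x , y)))  ∎
      where
      open ≡-Reasoning
      k = x + (y + x * (y₁ P + y₂ P))
      stable : ∀ {q} → fuelBound P q < fuelBound P (x , y) → sgFuel P k q ≡ uncurry (SG P) q
      stable {q} f<f = sgFuel-stable k _ q (≤-pred f<f) ≤-refl

≤ᵇ-true : ∀ {m n} → m ≤ n → (m ≤ᵇ n) ≡ true
≤ᵇ-true m≤n = Equivalence.to T-≡ (≤⇒≤ᵇ m≤n)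

≤ᵇ-false : ∀ {m n} → n < m → (m ≤ᵇ n) ≡ false
≤ᵇ-false {m} {n} n<m = ¬-not λ m≤ᵇn → <⇒≱ n<m (≤ᵇ⇒≤ m n (Equivalence.from T-≡ m≤ᵇn))

parity-suc : ∀ n → parity (suc n) ≡ parity n ⁻¹
parity-suc n = +-homo-+ 1 n

parity-pred : ∀ {n s} → parity (suc n) ≡ s → parity n ≡ s ⁻¹
parity-pred {n} e = sym (⁻¹-selfInverse (trans (sym (parity-suc n)) e))

parity-double : ∀ n → parity (n + n) ≡ 0ℙ
parity-double n = trans (+-homo-+ n n) (p+p≡0ℙ (parity n))

parity-+-even : ∀ m {n} → parity n ≡ 0ℙ → parity (m + n) ≡ parity m
parity-+-even m {n} n-even =
  trans (+-homo-+ m n) (trans (cong (parity m ℙ.+_) n-even) (ℙ.+-identityʳ (parity m)))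

parity-+-double : ∀ m n → parity (m + (n + n)) ≡ parity m
parity-+-double m n = parity-+-even m (parity-double n)

n%2≡0⇒parity≡0ℙ : ∀ n → n % 2 ≡ 0 → parity n ≡ 0ℙ
n%2≡0⇒parity≡0ℙ zero          _ = refl
n%2≡0⇒parity≡0ℙ (suc zero)    ()
n%2≡0⇒parity≡0ℙ (suc (suc n)) e = n%2≡0⇒parity≡0ℙ n e

n%2≡1⇒parity≡1ℙ : ∀ n → n % 2 ≡ 1 → parity n ≡ 1ℙ
n%2≡1⇒parity≡1ℙ zero          ()
n%2≡1⇒parity≡1ℙ (suc zero)    _ = refl
n%2≡1⇒parity≡1ℙ (suc (suc n)) e = n%2≡1⇒parity≡1ℙ n e

data Value : Set where
  v₀ v₁ v₂ v₃ : Value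

∀-Value : {Q : Value → Set} → Q v₀ → Q v₁ → Q v₂ → Q v₃ → ∀ a → Q a
∀-Value q₀ q₁ q₂ q₃ v₀ = q₀
∀-Value q₀ q₁ q₂ q₃ v₁ = q₁
∀-Value q₀ q₁ q₂ q₃ v₂ = q₂
∀-Value q₀ q₁ q₂ q₃ v₃ = q₃

toℕ : Value → ℕ
toℕ v₀ = 0
toℕ v₁ = 1
toℕ v₂ = 2
toℕ v₃ = 3

fromℕ : ℕ → Value
fromℕ 0 = v₀
fromℕ 1 = v₁
fromℕ 2 = v₂
fromℕ _ = v₃

fromℕ-toℕ : ∀ v → fromℕ (toℕ v) ≡ v
fromℕ-toℕ = ∀-Value refl refl refl refl

toℕ-injective : ∀ {a c} → toℕ a ≡ toℕ c → a ≡ c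
toℕ-injective {a} {c} eq = trans (sym (fromℕ-toℕ a)) (trans (cong fromℕ eq) (fromℕ-toℕ c))

xor1 : Value → Value
xor1 v₀ = v₁
xor1 v₁ = v₀
xor1 v₂ = v₃
xor1 v₃ = v₂

xor1-involutive : ∀ v → xor1 (xor1 v) ≡ v
xor1-involutive = ∀-Value refl refl refl refl

xor1≢ : ∀ v → xor1 v ≢ v
xor1≢ = ∀-Value (λ ()) (λ ()) (λ ()) (λ ())

flipIf : Parity → Value → Value
flipIf 0ℙ v = v
flipIf 1ℙ v = xor1 v

flipIf-⁻¹ : ∀ s v → flipIf (s ⁻¹) v ≡ flipIf s (xor1 v)
flipIf-⁻¹ 0ℙ v = refl
flipIf-⁻¹ 1ℙ v = sym (xor1-involutive v)

flipIf-parity-suc : ∀ q v → flipIf (parity (suc q)) v ≡ flipIf (parity q ⁻¹) v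
flipIf-parity-suc q v = cong (λ s → flipIf s v) (parity-suc q)

flipIf-parity-suc-xor1 : ∀ q v → flipIf (parity (suc q)) v ≡ flipIf (parity q) (xor1 v)
flipIf-parity-suc-xor1 q v = trans (flipIf-parity-suc q v) (flipIf-⁻¹ (parity q) v)

mex₂ : Value → Value → Value
mex₂ v₀ v₀ = v₁
mex₂ v₀ v₁ = v₂
mex₂ v₀ _  = v₁
mex₂ v₁ v₀ = v₂
mex₂ _  v₀ = v₁
mex₂ _  _  = v₀

mex-toℕ₂ : ∀ a c → mex (toℕ a ∷ toℕ c ∷ []) ≡ toℕ (mex₂ a c)
mex-toℕ₂ = ∀-Value (∀-Value refl refl refl refl) (∀-Value refl refl refl refl)
                   (∀-Value refl refl refl refl) (∀-Value refl refl refl refl)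

mex-flipIf₁ : ∀ s → mex (toℕ (flipIf s v₀) ∷ []) ≡ toℕ (flipIf (s ⁻¹) v₀)
mex-flipIf₁ 0ℙ = refl
mex-flipIf₁ 1ℙ = refl

-- The induction step showing that moving up b rows flips the value.
mex-flipIf₃ : ∀ s a c →
              mex (toℕ (flipIf s (mex₂ a c)) ∷ toℕ (flipIf (s ⁻¹) a) ∷ toℕ (flipIf (s ⁻¹) c) ∷ [])
              ≡ toℕ (flipIf (s ⁻¹) (mex₂ a c))
mex-flipIf₃ 0ℙ = ∀-Value (∀-Value refl refl refl refl) (∀-Value refl refl refl refl)
                         (∀-Value refl refl refl refl) (∀-Value refl refl refl refl)
mex-flipIf₃ 1ℙ = ∀-Value (∀-Value refl refl refl refl) (∀-Value refl refl refl refl)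
                         (∀-Value refl refl refl refl) (∀-Value refl refl refl refl)

fromParity : Parity → Value
fromParity 0ℙ = v₀
fromParity 1ℙ = v₁

fromParity-⁻¹ : ∀ s → fromParity (s ⁻¹) ≡ xor1 (fromParity s)
fromParity-⁻¹ 0ℙ = refl
fromParity-⁻¹ 1ℙ = refl

fromParity≢v₂ : ∀ s → fromParity s ≢ v₂
fromParity≢v₂ 0ℙ ()
fromParity≢v₂ 1ℙ ()

double : Parity → Value
double 0ℙ = v₀
double 1ℙ = v₂

mex₂-fromParity-double : ∀ s → mex₂ (fromParity s) (double s) ≡ xor1 (fromParity s)
mex₂-fromParity-double 0ℙ = refl
mex₂-fromParity-double 1ℙ = refl

mex₂-fromParity-same : ∀ s → mex₂ (fromParity s) (fromParity s) ≡ xor1 (fromParity s)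
mex₂-fromParity-same 0ℙ = refl
mex₂-fromParity-same 1ℙ = refl

-- Columns of L(b;1,0;1,c)

module Column (b c : ℕ) (1≤b : 1 ≤ b) where

  G : Params
  G = L b 1 0 1 c

  private
    SG-unfold : ∀ x y → SG G x y ≡ mex (map (uncurry (SG G)) (options G (x , y)))
    SG-unfold = SG-rec G 1≤b ≤-refl ≤-refl

  SG-0-< : ∀ r → r < b → SG G 0 r ≡ 0
  SG-0-< r r<b rewrite SG-unfold 0 r | ≤ᵇ-false r<b = refl

  SG-0-≥ : ∀ y → b ≤ y → SG G 0 y ≡ mex (SG G 0 (y ∸ b) ∷ [])
  SG-0-≥ y b≤y rewrite SG-unfold 0 y | ≤ᵇ-true b≤y = refl

  SG-suc-< : ∀ x r → r < b → SG G (suc x) r ≡ mex (SG G x (r + 0) ∷ SG G x (r + c) ∷ [])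
  SG-suc-< x r r<b rewrite SG-unfold (suc x) r | ≤ᵇ-false r<b = refl

  SG-suc-≥ : ∀ x y → b ≤ y →
             SG G (suc x) y ≡ mex (SG G (suc x) (y ∸ b) ∷ SG G x (y + 0) ∷ SG G x (y + c) ∷ [])
  SG-suc-≥ x y b≤y rewrite SG-unfold (suc x) y | ≤ᵇ-true b≤y = refl

  Profile : ℕ → (ℕ → Value) → Set
  Profile x h = ∀ q r → r < b → SG G x (q * b + r) ≡ toℕ (flipIf (parity q) (h r))

  ShiftedProfile : ℕ → (ℕ → Value) → Set
  ShiftedProfile x n = ∀ q r → r < b → SG G x (q * b + r + c) ≡ toℕ (flipIf (parity q) (n r))

  private
    below-b : ∀ q r → b ≤ suc q * b + r
    below-b q r = ≤-trans (m≤m+n b (q * b)) (m≤m+n _ r)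

    minus-b : ∀ q r → suc q * b + r ∸ b ≡ q * b + r
    minus-b q r = trans (cong (_∸ b) (+-assoc b (q * b) r)) (m+n∸m≡n b (q * b + r))

  profile-0 : Profile 0 (λ _ → v₀)
  profile-0 zero r r<b = SG-0-< r r<b
  profile-0 (suc q) r r<b = begin
    SG G 0 (suc q * b + r)                     ≡⟨ SG-0-≥ _ (below-b q r) ⟩
    mex (SG G 0 (suc q * b + r ∸ b) ∷ [])      ≡⟨ cong (λ v → mex (v ∷ [])) below ⟩
    mex (toℕ (flipIf (parity q) v₀) ∷ [])      ≡⟨ mex-flipIf₁ (parity q) ⟩
    toℕ (flipIf (parity q ⁻¹) v₀)              ≡⟨ cong toℕ (flipIf-parity-suc q v₀) ⟨
    toℕ (flipIf (parity (suc q)) v₀)           ∎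
    where
    open ≡-Reasoning
    below : SG G 0 (suc q * b + r ∸ b) ≡ toℕ (flipIf (parity q) v₀)
    below = trans (cong (SG G 0) (minus-b q r)) (profile-0 q r r<b)

  profile-suc : ∀ {x h n} → Profile x h → ShiftedProfile x n → Profile (suc x) (λ r → mex₂ (h r) (n r))
  profile-suc {x} {h} {n} hₓ nₓ zero r r<b = begin
    SG G (suc x) r                                 ≡⟨ SG-suc-< x r r<b ⟩
    mex (SG G x (r + 0) ∷ SG G x (r + c) ∷ [])     ≡⟨ cong₂ (λ u v → mex (u ∷ v ∷ [])) left (nₓ 0 r r<b) ⟩
    mex (toℕ (h r) ∷ toℕ (n r) ∷ [])               ≡⟨ mex-toℕ₂ (h r) (n r) ⟩
    toℕ (mex₂ (h r) (n r))                         ∎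
    where
    open ≡-Reasoning
    left : SG G x (r + 0) ≡ toℕ (h r)
    left = trans (cong (SG G x) (+-identityʳ r)) (hₓ 0 r r<b)
  profile-suc {x} {h} {n} hₓ nₓ (suc q) r r<b = begin
    SG G (suc x) (suc q * b + r)
      ≡⟨ SG-suc-≥ x _ (below-b q r) ⟩
    mex (SG G (suc x) (suc q * b + r ∸ b) ∷ SG G x (suc q * b + r + 0) ∷ SG G x (suc q * b + r + c) ∷ [])
      ≡⟨ cong₂ (λ u vw → mex (u ∷ vw)) below (cong₂ (λ v w → v ∷ w ∷ []) left right) ⟩
    mex (toℕ (flipIf s m) ∷ toℕ (flipIf (s ⁻¹) (h r)) ∷ toℕ (flipIf (s ⁻¹) (n r)) ∷ [])
      ≡⟨ mex-flipIf₃ s (h r) (n r) ⟩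
    toℕ (flipIf (s ⁻¹) m)
      ≡⟨ cong toℕ (flipIf-parity-suc q m) ⟨
    toℕ (flipIf (parity (suc q)) m)
      ∎
    where
    open ≡-Reasoning
    s = parity q
    m = mex₂ (h r) (n r)
    below : SG G (suc x) (suc q * b + r ∸ b) ≡ toℕ (flipIf s m)
    below = trans (cong (SG G (suc x)) (minus-b q r)) (profile-suc hₓ nₓ q r r<b)
    left : SG G x (suc q * b + r + 0) ≡ toℕ (flipIf (s ⁻¹) (h r))
    left = trans (cong (SG G x) (+-identityʳ _)) (trans (hₓ (suc q) r r<b) (cong toℕ (flipIf-parity-suc q (h r))))
    right : SG G x (suc q * b + r + c) ≡ toℕ (flipIf (s ⁻¹) (n r))
    right = trans (nₓ (suc q) r r<b) (cong toℕ (flipIf-parity-suc q (n r)))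

-- HPreperiodAndPeriod g unfolds to PreperiodAndPeriod (λ p x₀ → HPeriodicFrom g p x₀).
PreperiodAndPeriod : (ℕ → ℕ → Set) → ℕ → ℕ → Set
PreperiodAndPeriod Periodic x₀ p =
  (0 < p)
  × Periodic p x₀
  × (∀ p′ x₀′ → 0 < p′ → Periodic p′ x₀′ → p ≤ p′)
  × (∀ x₀′ → Periodic p x₀′ → x₀ ≤ x₀′)

PreperiodAndPeriod-⇔ : ∀ {Periodic Periodic′ : ℕ → ℕ → Set} →
                       (∀ p x₀ → Periodic p x₀ ⇔ Periodic′ p x₀) →
                       ∀ {x₀ p} → PreperiodAndPeriod Periodic x₀ p → PreperiodAndPeriod Periodic′ x₀ p
PreperiodAndPeriod-⇔ P⇔P′ (0<p , periodic , least-period , least-preperiod) =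
  0<p
  , Equivalence.to (P⇔P′ _ _) periodic
  , (λ p′ x₀′ 0<p′ periodic′ → least-period p′ x₀′ 0<p′ (Equivalence.from (P⇔P′ _ _) periodic′))
  , (λ x₀′ periodic′ → least-preperiod x₀′ (Equivalence.from (P⇔P′ _ _) periodic′))

-- The row automaton

checker : ℕ → ℕ → Value
checker x r = fromParity (parity (x + r))

checker-sucˡ : ∀ x r → checker (suc x) r ≡ xor1 (checker x r)
checker-sucˡ x r = trans (cong fromParity (parity-suc (x + r))) (fromParity-⁻¹ _)

checker-sucʳ : ∀ x r → checker x (suc r) ≡ xor1 (checker x r)
checker-sucʳ x r = trans (cong (fromParity ∘ parity) (+-suc x r)) (checker-sucˡ x r)

checker-step : ∀ x r → mex₂ (checker x (suc r)) (xor1 (checker x r)) ≡ checker (suc x) (suc r)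
checker-step x r = begin
  mex₂ (checker x (suc r)) (xor1 (checker x r))  ≡⟨ cong (λ v → mex₂ v (xor1 (checker x r))) (checker-sucʳ x r) ⟩
  mex₂ (xor1 (checker x r)) (xor1 (checker x r)) ≡⟨ mex₂-xor1 (parity (x + r)) ⟩
  checker x r                                    ≡⟨ cong (fromParity ∘ parity ∘ suc) (+-suc x r) ⟨
  checker (suc x) (suc r)                        ∎
  where
  open ≡-Reasoning
  mex₂-xor1 : ∀ s → mex₂ (xor1 (fromParity s)) (xor1 (fromParity s)) ≡ fromParity s
  mex₂-xor1 0ℙ = refl
  mex₂-xor1 1ℙ = refl

early : ℕ → ℕ → Value
early x r = if r <ᵇ x then checker x r else double (parity x)

early-< : ∀ {x r} → r < x → early x r ≡ checker x r
early-< {x} {r} r<x = cong (λ t → if t then checker x r else double (parity x)) (Equivalence.to T-≡ (<⇒<ᵇ r<x))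

early-≥ : ∀ {x r} → x ≤ r → early x r ≡ double (parity x)
early-≥ {x} {r} x≤r = cong (λ t → if t then checker x r else double (parity x))
                          (¬-not λ r<ᵇx → ≤⇒≯ x≤r (<ᵇ⇒< r x (Equivalence.from T-≡ r<ᵇx)))

early-step : ∀ x r → mex₂ (early x (suc r)) (xor1 (early x r)) ≡ early (suc x) (suc r)
early-step x r with <-cmp (suc r) x
... | tri< 1+r<x _ _ = begin
  mex₂ (early x (suc r)) (xor1 (early x r))
    ≡⟨ cong₂ (λ u v → mex₂ u (xor1 v)) (early-< 1+r<x) (early-< (<-trans (n<1+n r) 1+r<x)) ⟩
  mex₂ (checker x (suc r)) (xor1 (checker x r))  ≡⟨ checker-step x r ⟩
  checker (suc x) (suc r)                        ≡⟨ early-< (<-trans 1+r<x (n<1+n x)) ⟨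
  early (suc x) (suc r)                          ∎
  where open ≡-Reasoning
... | tri≈ _ refl _ = begin
  mex₂ (early (suc r) (suc r)) (xor1 (early (suc r) r))
    ≡⟨ cong₂ (λ u v → mex₂ u (xor1 v)) (early-≥ {suc r} ≤-refl) (early-< (n<1+n r)) ⟩
  mex₂ (double (parity (suc r))) (xor1 (fromParity (parity (suc r + r))))
    ≡⟨ cong (λ v → mex₂ (double (parity (suc r))) (xor1 (fromParity v))) parity-odd ⟩
  mex₂ (double (parity (suc r))) v₀              ≡⟨ mex₂-double-v₀ (parity (suc r)) ⟩
  v₁                                             ≡⟨ cong fromParity (trans (cong parity (+-suc r r)) parity-odd) ⟨
  checker (suc (suc r)) (suc r)                  ≡⟨ early-< (n<1+n (suc r)) ⟨
  early (suc (suc r)) (suc r)                    ∎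
  where
  open ≡-Reasoning
  parity-odd : parity (suc r + r) ≡ 1ℙ
  parity-odd = trans (parity-suc (r + r)) (cong _⁻¹ (parity-double r))
  mex₂-double-v₀ : ∀ s → mex₂ (double s) v₀ ≡ v₁
  mex₂-double-v₀ 0ℙ = refl
  mex₂-double-v₀ 1ℙ = refl
... | tri> _ _ x<1+r = begin
  mex₂ (early x (suc r)) (xor1 (early x r))
    ≡⟨ cong₂ (λ u v → mex₂ u (xor1 v)) (early-≥ (<⇒≤ x<1+r)) (early-≥ (≤-pred x<1+r)) ⟩
  mex₂ (double (parity x)) (xor1 (double (parity x)))  ≡⟨ mex₂-double (parity x) ⟩
  double (parity x ⁻¹)                                 ≡⟨ cong double (parity-suc x) ⟨
  double (parity (suc x))                              ≡⟨ early-≥ (s≤s (≤-pred x<1+r)) ⟨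
  early (suc x) (suc r)                                ∎
  where
  open ≡-Reasoning
  mex₂-double : ∀ s → mex₂ (double s) (xor1 (double s)) ≡ double (s ⁻¹)
  mex₂-double 0ℙ = refl
  mex₂-double 1ℙ = refl

module Automaton (b′ : ℕ) where

  B : ℕ
  B = suc b′

  neighbour : (ℕ → Value) → ℕ → Value
  neighbour ρ zero    = ρ b′
  neighbour ρ (suc r) = xor1 (ρ r)

  row : ℕ → ℕ → Value
  row zero    r = v₀
  row (suc x) r = mex₂ (row x r) (neighbour (row x) r)

  SameRow : ℕ → ℕ → Set
  SameRow x x′ = ∀ r → r < B → row x r ≡ row x′ r

  RowPeriodicFrom : ℕ → ℕ → Set
  RowPeriodicFrom p x₀ = ∀ x → x₀ ≤ x → SameRow (x + p) x

  SameRow-suc : ∀ {x x′} → SameRow x x′ → SameRow (suc x) (suc x′)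
  SameRow-suc same zero    r<B = cong₂ mex₂ (same 0 r<B) (same b′ ≤-refl)
  SameRow-suc same (suc r) r<B = cong₂ (λ u v → mex₂ u (xor1 v)) (same (suc r) r<B) (same r (<-trans (n<1+n r) r<B))

  row-early-suc : ∀ {x} → x < B → (∀ r → r < B → row x r ≡ early x r) →
                  ∀ r → r < B → row (suc x) r ≡ early (suc x) r
  row-early-suc {zero}  _   _  zero    _   = refl
  row-early-suc {suc x} x<B IH zero    r<B = begin
    mex₂ (row (suc x) 0) (row (suc x) b′)   ≡⟨ cong₂ mex₂ first last ⟩
    mex₂ (fromParity s) (double s)          ≡⟨ mex₂-fromParity-double s ⟩
    xor1 (checker (suc x) 0)                ≡⟨ checker-sucˡ (suc x) 0 ⟨
    checker (suc (suc x)) 0                 ≡⟨ early-< {suc (suc x)} (s≤s z≤n) ⟨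
    early (suc (suc x)) 0                   ∎
    where
    open ≡-Reasoning
    s = parity (suc x + 0)
    first : row (suc x) 0 ≡ fromParity s
    first = trans (IH 0 r<B) (early-< {suc x} (s≤s z≤n))
    last : row (suc x) b′ ≡ double s
    last = trans (IH b′ ≤-refl)
                 (trans (early-≥ (≤-pred x<B)) (cong (double ∘ parity) (sym (+-identityʳ (suc x)))))
  row-early-suc {x} x<B IH (suc r) r<B =
    trans (cong₂ (λ u v → mex₂ u (xor1 v)) (IH (suc r) r<B) (IH r (<-trans (n<1+n r) r<B))) (early-step x r)

  row-early : ∀ x → x ≤ B → ∀ r → r < B → row x r ≡ early x r
  row-early zero    _   r _ = sym (early-≥ {0} {r} z≤n)
  row-early (suc x) x<B     = row-early-suc x<B (row-early x (<⇒≤ x<B))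

  periodic-from : ∀ {K z} → SameRow (z + K) z → RowPeriodicFrom K z
  periodic-from {K} {z} same x z≤x = subst (λ t → SameRow (t + K) t) (m∸n+n≡m z≤x) (shifted (x ∸ z))
    where
    shifted : ∀ k → SameRow (k + z + K) (k + z)
    shifted zero    = same
    shifted (suc k) = SameRow-suc {k + z + K} {k + z} (shifted k)

  least-preperiod : ∀ {K w} → ¬ SameRow (w + K) w → ∀ x₀′ → RowPeriodicFrom K x₀′ → suc w ≤ x₀′
  least-preperiod {K} {w} differ x₀′ periodic with suc w ≤? x₀′
  ... | yes w<x₀′ = w<x₀′
  ... | no  w≮x₀′ = contradiction (periodic w (≤-pred (≰⇒> w≮x₀′))) differ

  iterate-period : ∀ {K z} → RowPeriodicFrom K z → ∀ N y → z ≤ y → SameRow (N * K + y) y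
  iterate-period periodic zero    y z≤y r r<B = refl
  iterate-period {K} periodic (suc N) y z≤y r r<B = begin
    row (suc N * K + y) r   ≡⟨ cong (λ t → row t r) (reorder N K y) ⟨
    row (N * K + y + K) r   ≡⟨ periodic (N * K + y) (≤-trans z≤y (m≤n+m y _)) r r<B ⟩
    row (N * K + y) r       ≡⟨ iterate-period periodic N y z≤y r r<B ⟩
    row y r                 ∎
    where
    open ≡-Reasoning
    reorder : ∀ N K y → N * K + y + K ≡ suc N * K + y
    reorder = solve-∀

  least-period : ∀ {K z y} → 0 < K → RowPeriodicFrom K z → z ≤ y →
                 (∀ p′ → 0 < p′ → p′ < K → ¬ SameRow (y + p′) y) →
                 ∀ p′ x₀′ → 0 < p′ → RowPeriodicFrom p′ x₀′ → K ≤ p′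
  least-period {K} {z} {y} 0<K periodic z≤y aperiodic p′ x₀′ 0<p′ periodic′ with K ≤? p′
  ... | yes K≤p′ = K≤p′
  ... | no  K≰p′ = contradiction shifted (aperiodic p′ 0<p′ (≰⇒> K≰p′))
    where
    X = x₀′ * K + y
    x₀′≤X : x₀′ ≤ X
    x₀′≤X = ≤-trans (m≤m*n x₀′ K {{>-nonZero 0<K}}) (m≤m+n _ y)
    z≤y+p′ : z ≤ y + p′
    z≤y+p′ = ≤-trans z≤y (m≤m+n y p′)
    shifted : SameRow (y + p′) y
    shifted r r<B = begin
      row (y + p′) r               ≡⟨ iterate-period periodic x₀′ (y + p′) z≤y+p′ r r<B ⟨
      row (x₀′ * K + (y + p′)) r   ≡⟨ cong (λ t → row t r) (+-assoc (x₀′ * K) y p′) ⟨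
      row (X + p′) r               ≡⟨ periodic′ X x₀′≤X r r<B ⟩
      row X r                      ≡⟨ iterate-period periodic x₀′ y z≤y r r<B ⟩
      row y r                      ∎
      where open ≡-Reasoning

  -- g reads the automaton through the permutation σ of the cells: the identity for c = b - 1,
  -- r ↦ b′ ∸ r for c = b + 1.
  module Reading (g : ℕ → ℕ → ℕ) (σ : ℕ → ℕ)
                 (σ-< : ∀ r → r < B → σ r < B) (σ-involutive : ∀ r → r < B → σ (σ r) ≡ r)
                 (g-row : ∀ x q r → r < B → g x (q * B + r) ≡ toℕ (flipIf (parity q) (row x (σ r))))
                 where

    g-row-div : ∀ x y → g x y ≡ toℕ (flipIf (parity (y / B)) (row x (σ (y % B))))
    g-row-div x y = trans (cong (g x) (trans (m≡m%n+[m/n]*n y B) (+-comm (y % B) _)))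
                          (g-row x (y / B) (y % B) (m%n<n y B))

    RowPeriodicFrom⇔HPeriodicFrom : ∀ p x₀ → RowPeriodicFrom p x₀ ⇔ HPeriodicFrom g p x₀
    RowPeriodicFrom⇔HPeriodicFrom p x₀ = mk⇔ to from
      where
      open ≡-Reasoning
      to : RowPeriodicFrom p x₀ → HPeriodicFrom g p x₀
      to periodic x y x₀≤x = begin
        g (x + p) y                                               ≡⟨ g-row-div (x + p) y ⟩
        toℕ (flipIf (parity (y / B)) (row (x + p) (σ (y % B))))   ≡⟨ cong (toℕ ∘ flipIf (parity (y / B))) same ⟩
        toℕ (flipIf (parity (y / B)) (row x (σ (y % B))))         ≡⟨ g-row-div x y ⟨
        g x y                                                     ∎
        where
        same : row (x + p) (σ (y % B)) ≡ row x (σ (y % B))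
        same = periodic x x₀≤x _ (σ-< _ (m%n<n y B))
      from : HPeriodicFrom g p x₀ → RowPeriodicFrom p x₀
      from periodic x x₀≤x r r<B = toℕ-injective (begin
        toℕ (row (x + p) r)          ≡⟨ cong (toℕ ∘ row (x + p)) (σ-involutive r r<B) ⟨
        toℕ (row (x + p) (σ (σ r)))  ≡⟨ g-row (x + p) 0 (σ r) (σ-< r r<B) ⟨
        g (x + p) (σ r)              ≡⟨ periodic x (σ r) x₀≤x ⟩
        g x (σ r)                    ≡⟨ g-row x 0 (σ r) (σ-< r r<B) ⟩
        toℕ (row x (σ (σ r)))        ≡⟨ cong (toℕ ∘ row x) (σ-involutive r r<B) ⟩
        toℕ (row x r)                ∎)

  module Minus = Column B b′ (s≤s z≤n)

  profile-minus : ∀ x → Minus.Profile x (row x)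
  profile-minus zero    = Minus.profile-0
  profile-minus (suc x) = Minus.profile-suc (profile-minus x) (shifted (profile-minus x))
    where
    shifted : Minus.Profile x (row x) → Minus.ShiftedProfile x (neighbour (row x))
    shifted rowₓ q zero    r<B =
      trans (cong (λ y → SG Minus.G x (y + b′)) (+-identityʳ (q * B))) (rowₓ q b′ ≤-refl)
    shifted rowₓ q (suc r) r<B = begin
      SG Minus.G x (q * B + suc r + b′)         ≡⟨ cong (SG Minus.G x) (shift q b′ r) ⟩
      SG Minus.G x (suc q * B + r)              ≡⟨ rowₓ (suc q) r (<-trans (n<1+n r) r<B) ⟩
      toℕ (flipIf (parity (suc q)) (row x r))   ≡⟨ cong toℕ (flipIf-parity-suc-xor1 q (row x r)) ⟩
      toℕ (flipIf (parity q) (xor1 (row x r)))  ∎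
      where
      open ≡-Reasoning
      shift : ∀ q b′ r → q * suc b′ + suc r + b′ ≡ suc q * suc b′ + r
      shift = solve-∀

  module Plus = Column B (B + 1) (s≤s z≤n)

  profile-plus : ∀ x → Plus.Profile x (λ r → row x (b′ ∸ r))
  profile-plus zero    = Plus.profile-0
  profile-plus (suc x) = Plus.profile-suc (profile-plus x) (shifted (profile-plus x))
    where
    shifted : Plus.Profile x (λ r → row x (b′ ∸ r)) →
              Plus.ShiftedProfile x (λ r → neighbour (row x) (b′ ∸ r))
    shifted rowₓ q r r<B with m<1+n⇒m<n∨m≡n r<B
    ... | inj₂ refl = begin
      SG Plus.G x (q * B + b′ + (B + 1))                      ≡⟨ cong (SG Plus.G x) (shift q b′) ⟩
      SG Plus.G x (suc (suc q) * B + 0)                       ≡⟨ rowₓ (suc (suc q)) 0 (s≤s z≤n) ⟩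
      toℕ (flipIf (parity q) (row x b′))                      ≡⟨ cong (toℕ ∘ flipIf (parity q) ∘ neighbour (row x)) (n∸n≡0 b′) ⟨
      toℕ (flipIf (parity q) (neighbour (row x) (b′ ∸ b′)))   ∎
      where
      open ≡-Reasoning
      shift : ∀ q b′ → q * suc b′ + b′ + (suc b′ + 1) ≡ suc (suc q) * suc b′ + 0
      shift = solve-∀
    ... | inj₁ r<b′ = begin
      SG Plus.G x (q * B + r + (B + 1))                       ≡⟨ cong (SG Plus.G x) (shift q b′ r) ⟩
      SG Plus.G x (suc q * B + suc r)                         ≡⟨ rowₓ (suc q) (suc r) (s≤s r<b′) ⟩
      toℕ (flipIf (parity (suc q)) (row x (b′ ∸ suc r)))      ≡⟨ cong toℕ (flipIf-parity-suc-xor1 q _) ⟩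
      toℕ (flipIf (parity q) (neighbour (row x) (suc (b′ ∸ suc r))))
        ≡⟨ cong (toℕ ∘ flipIf (parity q) ∘ neighbour (row x)) (+-∸-assoc 1 r<b′) ⟨
      toℕ (flipIf (parity q) (neighbour (row x) (b′ ∸ r)))    ∎
      where
      open ≡-Reasoning
      shift : ∀ q b′ r → q * suc b′ + r + (suc b′ + 1) ≡ suc q * suc b′ + suc r
      shift = solve-∀

  periods-minus : ∀ p x₀ → RowPeriodicFrom p x₀ ⇔ HPeriodicFrom (SG Minus.G) p x₀
  periods-minus = Reading.RowPeriodicFrom⇔HPeriodicFrom (SG Minus.G) (λ r → r) (λ r r<B → r<B) (λ r _ → refl)
                    profile-minus

  periods-plus : ∀ p x₀ → RowPeriodicFrom p x₀ ⇔ HPeriodicFrom (SG Plus.G) p x₀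
  periods-plus = Reading.RowPeriodicFrom⇔HPeriodicFrom (SG Plus.G) (b′ ∸_) (λ r _ → s≤s (m∸n≤m b′ r))
                   (λ r r<B → m∸[m∸n]≡n (≤-pred r<B)) profile-plus

-- Odd b

module Odd (b′ : ℕ) (b′-even : parity b′ ≡ 0ℙ) where
  open Automaton b′

  Checkered : ℕ → Set
  Checkered x = ∀ r → r < B → row x r ≡ checker x r

  checkered-b′ : Checkered b′
  checkered-b′ r r<B with m<1+n⇒m<n∨m≡n r<B
  ... | inj₁ r<b′ = trans (row-early b′ (n≤1+n b′) r r<B) (early-< r<b′)
  ... | inj₂ refl = begin
    row b′ b′               ≡⟨ row-early b′ (n≤1+n b′) b′ r<B ⟩
    early b′ b′             ≡⟨ early-≥ {b′} ≤-refl ⟩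
    double (parity b′)      ≡⟨ cong double b′-even ⟩
    v₀                      ≡⟨ cong fromParity (parity-double b′) ⟨
    checker b′ b′           ∎
    where open ≡-Reasoning

  checkered-suc : ∀ {x} → Checkered x → Checkered (suc x)
  checkered-suc {x} rowₓ zero r<B = begin
    mex₂ (row x 0) (row x b′)         ≡⟨ cong₂ mex₂ (rowₓ 0 r<B) (trans (rowₓ b′ ≤-refl) last≡first) ⟩
    mex₂ (checker x 0) (checker x 0)  ≡⟨ mex₂-fromParity-same (parity (x + 0)) ⟩
    xor1 (checker x 0)                ≡⟨ checker-sucˡ x 0 ⟨
    checker (suc x) 0                 ∎
    where
    open ≡-Reasoning
    last≡first : checker x b′ ≡ checker x 0
    last≡first = cong fromParity (trans (parity-+-even x b′-even) (cong parity (sym (+-identityʳ x))))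
  checkered-suc {x} rowₓ (suc r) r<B =
    trans (cong₂ (λ u v → mex₂ u (xor1 v)) (rowₓ (suc r) r<B) (rowₓ r (<-trans (n<1+n r) r<B))) (checker-step x r)

  checkered : ∀ x → b′ ≤ x → Checkered x
  checkered x b′≤x = subst Checkered (m∸n+n≡m b′≤x) (from-b′ (x ∸ b′))
    where
    from-b′ : ∀ k → Checkered (k + b′)
    from-b′ zero    = checkered-b′
    from-b′ (suc k) = checkered-suc {k + b′} (from-b′ k)

  periodic : RowPeriodicFrom 2 b′
  periodic x b′≤x r r<B = begin
    row (x + 2) r      ≡⟨ checkered (x + 2) (≤-trans b′≤x (m≤m+n x 2)) r r<B ⟩
    checker (x + 2) r  ≡⟨ cong fromParity (trans (cong parity (reorder x r)) (parity-+-double (x + r) 1)) ⟩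
    checker x r        ≡⟨ checkered x b′≤x r r<B ⟨
    row x r            ∎
    where
    open ≡-Reasoning
    reorder : ∀ x r → x + 2 + r ≡ x + r + (1 + 1)
    reorder = solve-∀

  aperiodic : ∀ p′ → 0 < p′ → p′ < 2 → ¬ SameRow (b′ + p′) b′
  aperiodic (suc (suc _)) _ (s≤s (s≤s ()))
  aperiodic (suc zero) _ _ same = xor1≢ (checker b′ 0) (begin
    xor1 (checker b′ 0)   ≡⟨ checker-sucˡ b′ 0 ⟨
    checker (suc b′) 0    ≡⟨ cong (λ t → checker t 0) (+-comm 1 b′) ⟩
    checker (b′ + 1) 0    ≡⟨ checkered (b′ + 1) (m≤m+n b′ 1) 0 (s≤s z≤n) ⟨
    row (b′ + 1) 0        ≡⟨ same 0 (s≤s z≤n) ⟩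
    row b′ 0              ≡⟨ checkered b′ ≤-refl 0 (s≤s z≤n) ⟩
    checker b′ 0          ∎)
    where open ≡-Reasoning

  rows : (∀ x₀′ → RowPeriodicFrom 2 x₀′ → b′ ≤ x₀′) → PreperiodAndPeriod RowPeriodicFrom b′ 2
  rows least-preperiod′ =
    s≤s z≤n , periodic , least-period (s≤s z≤n) periodic ≤-refl aperiodic , least-preperiod′

odd-rows : ∀ b′ → parity b′ ≡ 0ℙ → PreperiodAndPeriod (Automaton.RowPeriodicFrom b′) b′ 2
odd-rows zero    b′-even = Odd.rows zero b′-even (λ _ _ → z≤n)
odd-rows (suc w) b′-even = rows (least-preperiod differ)
  where
  open Automaton (suc w)
  open Odd (suc w) b′-even
  differ : ¬ SameRow (w + 2) w
  differ same = fromParity≢v₂ _ (begin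
    checker (w + 2) (suc w)   ≡⟨ checkered (w + 2) (≤-trans (n≤1+n (suc w)) (≤-reflexive (+-comm 2 w))) (suc w) ≤-refl ⟨
    row (w + 2) (suc w)       ≡⟨ same (suc w) ≤-refl ⟩
    row w (suc w)             ≡⟨ row-early w (≤-trans (n≤1+n w) (n≤1+n _)) (suc w) ≤-refl ⟩
    early w (suc w)           ≡⟨ early-≥ (n≤1+n w) ⟩
    double (parity w)         ≡⟨ cong double (parity-pred {w} b′-even) ⟩
    v₂                        ∎)
    where open ≡-Reasoning

-- Even b

data Cell : Set where
  phase antiphase two : Cell

∀-Cell : {Q : Cell → Set} → Q phase → Q antiphase → Q two → ∀ d → Q d
∀-Cell q₀ q₁ q₂ phase     = q₀
∀-Cell q₀ q₁ q₂ antiphase = q₁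
∀-Cell q₀ q₁ q₂ two       = q₂

invert : Cell → Cell
invert phase     = antiphase
invert antiphase = phase
invert two       = two

invert≡two : ∀ {d} → invert d ≡ two → d ≡ two
invert≡two {two} _ = refl

cellStep : Cell → Cell → Cell
cellStep phase     phase     = phase
cellStep antiphase antiphase = antiphase
cellStep two       e         = e
cellStep d         two       = d
cellStep _         _         = two

cellStep-invert : ∀ d e → cellStep (invert d) (invert e) ≡ invert (cellStep d e)
cellStep-invert = ∀-Cell (∀-Cell refl refl refl) (∀-Cell refl refl refl) (∀-Cell refl refl refl)

NotBothTwo : Cell → Cell → Set
NotBothTwo two two = ⊥
NotBothTwo _   _   = ⊤

NotBothTwo-≢ : ∀ {d} e → d ≢ two → NotBothTwo d e
NotBothTwo-≢ {phase}     e _    = tt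
NotBothTwo-≢ {antiphase} e _    = tt
NotBothTwo-≢ {two}       e d≢2 = contradiction refl d≢2

NotBothTwo-invert : ∀ d e → NotBothTwo d e → NotBothTwo (invert d) (invert e)
NotBothTwo-invert = ∀-Cell (λ _ _ → tt) (λ _ _ → tt) (∀-Cell (λ _ → tt) (λ _ → tt) (λ ()))

paint : Parity → Cell → Value
paint s phase     = fromParity s
paint s antiphase = fromParity (s ⁻¹)
paint s two       = v₂

paint≡v₂ : ∀ s d → paint s d ≡ v₂ → d ≡ two
paint≡v₂ s phase     e = contradiction e (fromParity≢v₂ s)
paint≡v₂ s antiphase e = contradiction e (fromParity≢v₂ (s ⁻¹))
paint≡v₂ s two       _ = refl

paint-step : ∀ s d e → NotBothTwo d e → mex₂ (paint (s ⁻¹) d) (xor1 (paint s e)) ≡ paint s (cellStep d e)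
paint-step 0ℙ = ∀-Cell (∀-Cell (λ _ → refl) (λ _ → refl) (λ _ → refl))
                       (∀-Cell (λ _ → refl) (λ _ → refl) (λ _ → refl))
                       (∀-Cell (λ _ → refl) (λ _ → refl) (λ ()))
paint-step 1ℙ = ∀-Cell (∀-Cell (λ _ → refl) (λ _ → refl) (λ _ → refl))
                       (∀-Cell (λ _ → refl) (λ _ → refl) (λ _ → refl))
                       (∀-Cell (λ _ → refl) (λ _ → refl) (λ ()))

paint-wrap : ∀ s d e → NotBothTwo d (invert e) →
             mex₂ (paint s d) (paint (s ⁻¹) e) ≡ paint (s ⁻¹) (cellStep d (invert e))
paint-wrap 0ℙ = ∀-Cell (∀-Cell (λ _ → refl) (λ _ → refl) (λ _ → refl))
                       (∀-Cell (λ _ → refl) (λ _ → refl) (λ _ → refl))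
                       (∀-Cell (λ _ → refl) (λ _ → refl) (λ ()))
paint-wrap 1ℙ = ∀-Cell (∀-Cell (λ _ → refl) (λ _ → refl) (λ _ → refl))
                       (∀-Cell (λ _ → refl) (λ _ → refl) (λ _ → refl))
                       (∀-Cell (λ _ → refl) (λ _ → refl) (λ ()))

wave : ℕ → ℕ → Cell
wave zero    r       = phase
wave (suc j) zero    = antiphase
wave (suc j) (suc r) = wave j r

crest : ℕ → ℕ → Cell
crest zero    zero    = two
crest zero    (suc r) = phase
crest (suc j) zero    = antiphase
crest (suc j) (suc r) = crest j r

wave-< : ∀ {j r} → r < j → wave j r ≡ antiphase
wave-< {suc j} {zero}  _         = refl
wave-< {suc j} {suc r} (s≤s r<j) = wave-< r<j

wave-≥ : ∀ {j r} → j ≤ r → wave j r ≡ phase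
wave-≥ {zero}  _         = refl
wave-≥ {suc j} (s≤s j≤r) = wave-≥ j≤r

wave≢two : ∀ j r → wave j r ≢ two
wave≢two zero    r       ()
wave≢two (suc j) zero    ()
wave≢two (suc j) (suc r) = wave≢two j r

crest-> : ∀ {j r} → j < r → crest j r ≡ phase
crest-> {zero}  {suc r} _         = refl
crest-> {suc j} {suc r} (s≤s j<r) = crest-> j<r

crest₀≡two : ∀ {j} → crest j 0 ≡ two → j ≡ 0
crest₀≡two {zero} _ = refl

crest-step : ∀ j r → crest j (suc r) ≡ cellStep (wave j (suc r)) (wave j r)
crest-step zero          r       = refl
crest-step (suc zero)    zero    = refl
crest-step (suc (suc j)) zero    = refl
crest-step (suc j)       (suc r) = crest-step j r

wave-step : ∀ j r → wave (suc j) (suc r) ≡ cellStep (crest j (suc r)) (crest j r)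
wave-step zero          zero    = refl
wave-step zero          (suc r) = refl
wave-step (suc zero)    zero    = refl
wave-step (suc (suc j)) zero    = refl
wave-step (suc j)       (suc r) = wave-step j r

crest-NotBothTwo : ∀ j r → NotBothTwo (crest j (suc r)) (crest j r)
crest-NotBothTwo zero          r       = tt
crest-NotBothTwo (suc zero)    zero    = tt
crest-NotBothTwo (suc (suc j)) zero    = tt
crest-NotBothTwo (suc j)       (suc r) = crest-NotBothTwo j r

cellStep-antiphase-crest : ∀ {j r} → j ≤ r → cellStep antiphase (invert (crest j r)) ≡ antiphase
cellStep-antiphase-crest {zero}  {zero}  _         = refl
cellStep-antiphase-crest {zero}  {suc r} _         = refl
cellStep-antiphase-crest {suc j} {suc r} (s≤s j≤r) = cellStep-antiphase-crest j≤r

data Half : ℕ → Set where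
  even : ∀ j → Half (j + j)
  odd  : ∀ j → Half (suc (j + j))

half : ∀ k → Half k
half zero = even zero
half (suc k) with half k
... | even j = odd j
... | odd  j = subst Half (cong suc (+-suc j j)) (even (suc j))

half-< : ∀ {j n} → j + j < n + n → j < n
half-< j+j<n+n = ≰⇒> λ n≤j → <⇒≱ j+j<n+n (+-mono-≤ n≤j n≤j)

module Even (z : ℕ) (z-even : parity z ≡ 0ℙ) where
  b′ : ℕ
  b′ = suc z

  open Automaton b′

  Painted : ℕ → (ℕ → Cell) → Set
  Painted x δ = ∀ r → r < B → row x r ≡ paint (parity (x + r)) (δ r)

  Painted-cong : ∀ {x δ δ′} → (∀ r → r < B → δ r ≡ δ′ r) → Painted x δ → Painted x δ′
  Painted-cong {x} δ≡δ′ painted r r<B =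
    trans (painted r r<B) (cong (paint (parity (x + r))) (δ≡δ′ r r<B))

  -- Cell b′ is an odd distance away from cell 0, so seen from cell 0 its phase is inverted.
  cellNeighbour : (ℕ → Cell) → ℕ → Cell
  cellNeighbour δ zero    = invert (δ b′)
  cellNeighbour δ (suc r) = δ r

  Evolves : (ℕ → Cell) → (ℕ → Cell) → Set
  Evolves δ δ′ = ∀ r → r < B → NotBothTwo (δ r) (cellNeighbour δ r)
                             × δ′ r ≡ cellStep (δ r) (cellNeighbour δ r)

  painted-suc : ∀ {x δ δ′} → Painted x δ → Evolves δ δ′ → Painted (suc x) δ′
  painted-suc {x} {δ} {δ′} rowₓ evolves zero r<B = begin
    mex₂ (row x 0) (row x b′)                               ≡⟨ cong₂ mex₂ (rowₓ 0 r<B) (rowₓ b′ ≤-refl) ⟩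
    mex₂ (paint s (δ 0)) (paint (parity (x + b′)) (δ b′))   ≡⟨ cong (λ t → mex₂ (paint s (δ 0)) (paint t (δ b′))) last ⟩
    mex₂ (paint s (δ 0)) (paint (s ⁻¹) (δ b′))              ≡⟨ paint-wrap s (δ 0) (δ b′) (proj₁ (evolves 0 r<B)) ⟩
    paint (s ⁻¹) (cellStep (δ 0) (invert (δ b′)))           ≡⟨ cong₂ paint (parity-suc (x + 0)) (proj₂ (evolves 0 r<B)) ⟨
    paint (parity (suc x + 0)) (δ′ 0)                       ∎
    where
    open ≡-Reasoning
    s = parity (x + 0)
    last : parity (x + b′) ≡ s ⁻¹
    last = begin
      parity (x + suc z)     ≡⟨ cong parity (+-suc x z) ⟩
      parity (suc (x + z))   ≡⟨ parity-suc (x + z) ⟩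
      parity (x + z) ⁻¹      ≡⟨ cong _⁻¹ (parity-+-even x z-even) ⟩
      parity x ⁻¹            ≡⟨ cong (_⁻¹ ∘ parity) (+-identityʳ x) ⟨
      s ⁻¹                   ∎
  painted-suc {x} {δ} {δ′} rowₓ evolves (suc r) r<B = begin
    mex₂ (row x (suc r)) (xor1 (row x r))
      ≡⟨ cong₂ (λ u v → mex₂ u (xor1 v)) (rowₓ (suc r) r<B) (rowₓ r (<-trans (n<1+n r) r<B)) ⟩
    mex₂ (paint (parity (x + suc r)) (δ (suc r))) (xor1 (paint s (δ r)))
      ≡⟨ cong (λ t → mex₂ (paint t (δ (suc r))) (xor1 (paint s (δ r)))) next ⟩
    mex₂ (paint (s ⁻¹) (δ (suc r))) (xor1 (paint s (δ r)))
      ≡⟨ paint-step s (δ (suc r)) (δ r) (proj₁ (evolves (suc r) r<B)) ⟩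
    paint s (cellStep (δ (suc r)) (δ r))
      ≡⟨ cong₂ paint (cong (parity ∘ suc) (+-suc x r)) (proj₂ (evolves (suc r) r<B)) ⟨
    paint (parity (suc x + suc r)) (δ′ (suc r))
      ∎
    where
    open ≡-Reasoning
    s = parity (x + r)
    next : parity (x + suc r) ≡ s ⁻¹
    next = trans (cong parity (+-suc x r)) (parity-suc (x + r))

  evolves-invert : ∀ {δ δ′} → Evolves δ δ′ → Evolves (invert ∘ δ) (invert ∘ δ′)
  evolves-invert {δ} {δ′} evolves r r<B =
    subst (NotBothTwo (invert (δ r))) (sym (neighbour-invert r)) (NotBothTwo-invert _ _ (proj₁ (evolves r r<B))) ,
    (begin
      invert (δ′ r)                                         ≡⟨ cong invert (proj₂ (evolves r r<B)) ⟩
      invert (cellStep (δ r) (cellNeighbour δ r))           ≡⟨ cellStep-invert (δ r) (cellNeighbour δ r) ⟨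
      cellStep (invert (δ r)) (invert (cellNeighbour δ r))  ≡⟨ cong (cellStep (invert (δ r))) (neighbour-invert r) ⟨
      cellStep (invert (δ r)) (cellNeighbour (invert ∘ δ) r) ∎)
    where
    open ≡-Reasoning
    neighbour-invert : ∀ r → cellNeighbour (invert ∘ δ) r ≡ invert (cellNeighbour δ r)
    neighbour-invert zero    = refl
    neighbour-invert (suc r) = refl

  evolves-wave : ∀ j → j ≤ b′ → Evolves (wave j) (crest j)
  evolves-wave zero    _    zero    _ = tt , refl
  evolves-wave (suc j) j<b′ zero    _ = tt , cong (λ d → cellStep antiphase (invert d)) (sym (wave-≥ j<b′))
  evolves-wave j       _    (suc r) _ = NotBothTwo-≢ _ (wave≢two j (suc r)) , crest-step j r

  evolves-crest : ∀ j → j ≤ b′ → Evolves (crest j) (wave (suc j))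
  evolves-crest zero    _    zero    _ = tt , refl
  evolves-crest (suc j) j<b′ zero    _ = tt , sym (cellStep-antiphase-crest j<b′)
  evolves-crest j       _    (suc r) _ = crest-NotBothTwo j r , wave-step j r

  module Sweep (T : Cell → Cell) (T-evolves : ∀ {δ δ′} → Evolves δ δ′ → Evolves (T ∘ δ) (T ∘ δ′))
               (X : ℕ) (start : Painted X (λ _ → T phase)) where
    mutual
      sweep-wave : ∀ j → j ≤ B → Painted (j + j + X) (T ∘ wave j)
      sweep-wave zero    _   = start
      sweep-wave (suc j) j<B =
        subst (λ t → Painted t (T ∘ wave (suc j))) (reindex j X)
              (painted-suc {suc (j + j + X)} (sweep-crest j j≤b′) (T-evolves (evolves-crest j j≤b′)))
        where
        j≤b′ = ≤-pred j<B
        reindex : ∀ j X → suc (suc (j + j + X)) ≡ suc j + suc j + X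
        reindex = solve-∀

      sweep-crest : ∀ j → j ≤ b′ → Painted (suc (j + j + X)) (T ∘ crest j)
      sweep-crest j j≤b′ =
        painted-suc {j + j + X} (sweep-wave j (≤-trans j≤b′ (n≤1+n b′))) (T-evolves (evolves-wave j j≤b′))

  module First = Sweep (λ d → d) (λ evolves → evolves) B
                       (λ r r<B → trans (row-early B ≤-refl r r<B) (early-< r<B))

  module Second = Sweep invert evolves-invert (B + B + B)
                        (Painted-cong {B + B + B} (λ r r<B → wave-< r<B) (First.sweep-wave B ≤-refl))

  period-start : SameRow (z + 4 * B) z
  period-start r r<B = begin
    row (z + 4 * B) r                                                ≡⟨ cong (λ t → row t r) (reindex z) ⟩
    row (b′ + b′ + (B + B + B)) r                                    ≡⟨ Second.sweep-wave b′ (n≤1+n b′) r r<B ⟩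
    paint (parity (b′ + b′ + (B + B + B) + r)) (invert (wave b′ r))  ≡⟨ cong (λ s → paint s (invert (wave b′ r))) shift ⟩
    paint (parity (z + r)) (invert (wave b′ r))                      ≡⟨ last-sweep ⟩
    early z r                                                        ≡⟨ row-early z (≤-trans (n≤1+n z) (n≤1+n b′)) r r<B ⟨
    row z r                                                          ∎
    where
    open ≡-Reasoning
    reindex : ∀ z → z + 4 * suc (suc z) ≡ suc z + suc z + (suc (suc z) + suc (suc z) + suc (suc z))
    reindex = solve-∀
    reorder : ∀ z r → suc z + suc z + (suc (suc z) + suc (suc z) + suc (suc z)) + r
                      ≡ z + r + ((suc (suc z) + suc (suc z)) + (suc (suc z) + suc (suc z)))
    reorder = solve-∀
    shift : parity (b′ + b′ + (B + B + B) + r) ≡ parity (z + r)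
    shift = trans (cong parity (reorder z r)) (parity-+-double (z + r) (B + B))
    last-sweep : paint (parity (z + r)) (invert (wave b′ r)) ≡ early z r
    last-sweep with <-cmp r z
    ... | tri< r<z _ _ =
      trans (cong (paint (parity (z + r)) ∘ invert) (wave-< (<-trans r<z (n<1+n z)))) (sym (early-< r<z))
    ... | tri≈ _ refl _ = begin
      paint (parity (z + z)) (invert (wave b′ z))   ≡⟨ cong (paint (parity (z + z)) ∘ invert) (wave-< (n<1+n z)) ⟩
      fromParity (parity (z + z))                   ≡⟨ cong fromParity (parity-double z) ⟩
      v₀                                            ≡⟨ cong double z-even ⟨
      double (parity z)                             ≡⟨ early-≥ {z} ≤-refl ⟨
      early z z                                     ∎
    ... | tri> _ _ z<r with ≤-antisym (≤-pred r<B) z<r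
    ...   | refl = begin
      paint (parity (z + b′)) (invert (wave b′ b′))  ≡⟨ cong (paint (parity (z + b′)) ∘ invert) (wave-≥ {b′} ≤-refl) ⟩
      fromParity (parity (z + suc z) ⁻¹)             ≡⟨ cong (λ s → fromParity (s ⁻¹)) parity-odd ⟩
      v₀                                             ≡⟨ cong double z-even ⟨
      double (parity z)                              ≡⟨ early-≥ (n≤1+n z) ⟨
      early z (suc z)                                ∎
      where
      parity-odd : parity (z + suc z) ≡ 1ℙ
      parity-odd = trans (cong parity (+-suc z z)) (trans (parity-suc (z + z)) (cong _⁻¹ (parity-double z)))

  periodic : RowPeriodicFrom (4 * B) z
  periodic = periodic-from {4 * B} period-start

  painted-origin-two : ∀ {x y} δ → x ≡ y → Painted y δ → row x 0 ≡ v₂ → δ 0 ≡ two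
  painted-origin-two δ refl painted is-two = paint≡v₂ _ _ (trans (sym (painted 0 (s≤s z≤n))) is-two)

  second-half : ∀ {J} → (B + J) + (B + J) < 4 * B → J < B
  second-half {J} lt = +-cancelˡ-< B J B (half-< (subst ((B + J) + (B + J) <_) (four-times B) lt))
    where
    four-times : ∀ n → 4 * n ≡ (n + n) + (n + n)
    four-times = solve-∀

  two-at-origin-even : ∀ j → j + j < 4 * B → row (suc B + (j + j)) 0 ≡ v₂ → j ≡ 0 ⊎ j ≡ B
  two-at-origin-even j bound is-two with j ≤? b′
  ... | yes j≤b′ =
    inj₁ (crest₀≡two (painted-origin-two (crest j) (reindex j B) (First.sweep-crest j j≤b′) is-two))
    where
    reindex : ∀ j B → suc B + (j + j) ≡ suc (j + j + B)
    reindex = solve-∀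
  ... | no j≰b′ with m≤n⇒∃[o]m+o≡n (≰⇒> j≰b′)
  ...   | J , refl = inj₂ (trans (cong (B +_) (crest₀≡two (invert≡two crest-two))) (+-identityʳ B))
    where
    reindex : ∀ J B → suc B + ((B + J) + (B + J)) ≡ suc (J + J + (B + B + B))
    reindex = solve-∀
    crest-two : invert (crest J 0) ≡ two
    crest-two = painted-origin-two (invert ∘ crest J) (reindex J B)
                  (Second.sweep-crest J (≤-pred (second-half bound))) is-two

  no-two-at-origin-odd : ∀ j → suc (j + j) < 4 * B → row (suc B + suc (j + j)) 0 ≢ v₂
  no-two-at-origin-odd j bound is-two with suc j ≤? B
  ... | yes j<B =
    wave≢two (suc j) 0 (painted-origin-two (wave (suc j)) (reindex j B) (First.sweep-wave (suc j) j<B) is-two)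
    where
    reindex : ∀ j B → suc B + suc (j + j) ≡ suc j + suc j + B
    reindex = solve-∀
  ... | no j≮B with m≤n⇒∃[o]m+o≡n (≤-pred (≰⇒> j≮B))
  ...   | J , refl = wave≢two (suc J) 0 (invert≡two wave-two)
    where
    reindex : ∀ J B → suc B + suc ((B + J) + (B + J)) ≡ suc J + suc J + (B + B + B)
    reindex = solve-∀
    wave-two : invert (wave (suc J) 0) ≡ two
    wave-two = painted-origin-two (invert ∘ wave (suc J)) (reindex J B)
                 (Second.sweep-wave (suc J) (second-half (<-trans (n<1+n _) bound))) is-two

  two-at-origin : ∀ k → k < 4 * B → row (suc B + k) 0 ≡ v₂ → k ≡ 0 ⊎ k ≡ B + B
  two-at-origin k k<4B is-two with half k
  ... | even j = Sum.map (cong (λ j → j + j)) (cong (λ j → j + j)) (two-at-origin-even j k<4B is-two)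
  ... | odd  j = contradiction is-two (no-two-at-origin-odd j k<4B)

  aperiodic : ∀ p′ → 0 < p′ → p′ < 4 * B → ¬ SameRow (suc B + p′) (suc B)
  aperiodic p′ 0<p′ p′<4B same with two-at-origin p′ p′<4B (trans (same 0 (s≤s z≤n)) origin-two)
    where
    origin-two : row (suc B) 0 ≡ v₂
    origin-two = First.sweep-crest 0 z≤n 0 (s≤s z≤n)
  ... | inj₁ refl = <-irrefl refl 0<p′
  ... | inj₂ refl = xor1≢ (fromParity s) (begin
    xor1 (fromParity s)                              ≡⟨ fromParity-⁻¹ s ⟨
    fromParity (s ⁻¹)                                ≡⟨ cong (λ t → fromParity (t ⁻¹)) shift ⟨
    paint (parity (suc (B + B + B) + 1)) antiphase   ≡⟨ Second.sweep-crest 0 z≤n 1 (s≤s (s≤s z≤n)) ⟨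
    row (suc (B + B + B)) 1                          ≡⟨ cong (λ t → row t 1) (reindex B) ⟨
    row (suc B + (B + B)) 1                          ≡⟨ same 1 (s≤s (s≤s z≤n)) ⟩
    row (suc B) 1                                    ≡⟨ First.sweep-crest 0 z≤n 1 (s≤s (s≤s z≤n)) ⟩
    fromParity s                                     ∎)
    where
    open ≡-Reasoning
    s = parity (suc B + 1)
    reindex : ∀ B → suc B + (B + B) ≡ suc (B + B + B)
    reindex = solve-∀
    reorder : ∀ B → suc (B + B + B) + 1 ≡ suc B + 1 + (B + B)
    reorder = solve-∀
    shift : parity (suc (B + B + B) + 1) ≡ s
    shift = trans (cong parity (reorder B)) (parity-+-double (suc B + 1) B)

  rows : (∀ x₀′ → RowPeriodicFrom (4 * B) x₀′ → z ≤ x₀′) → PreperiodAndPeriod RowPeriodicFrom z (4 * B)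
  rows least-preperiod′ =
    s≤s z≤n , periodic , least-period (s≤s z≤n) periodic z≤1+B aperiodic , least-preperiod′
    where
    z≤1+B : z ≤ suc B
    z≤1+B = ≤-trans (n≤1+n z) (≤-trans (n≤1+n b′) (n≤1+n B))

even-rows : ∀ z → parity z ≡ 0ℙ → PreperiodAndPeriod (Automaton.RowPeriodicFrom (suc z)) z (4 * suc (suc z))
even-rows zero    z-even = Even.rows zero z-even (λ _ _ → z≤n)
even-rows (suc w) z-even = rows (least-preperiod differ)
  where
  open Even (suc w) z-even
  open Automaton b′
  X = suc (suc w + suc w + (B + B + B))
  differ : ¬ SameRow (w + 4 * B) w
  differ same = fromParity≢v₂ (s ⁻¹) (begin
    fromParity (s ⁻¹)                    ≡⟨ cong (paint s ∘ invert) (crest-> {suc w} {b′} ≤-refl) ⟨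
    paint s (invert (crest (suc w) b′))  ≡⟨ Second.sweep-crest (suc w) (n≤1+n _) b′ ≤-refl ⟨
    row X b′                             ≡⟨ cong (λ t → row t b′) (reindex w) ⟨
    row (w + 4 * B) b′                   ≡⟨ same b′ ≤-refl ⟩
    row w b′                             ≡⟨ row-early w (≤-trans (n≤1+n w) (≤-trans (n≤1+n _) (n≤1+n _))) b′ ≤-refl ⟩
    early w b′                           ≡⟨ early-≥ (≤-trans (n≤1+n w) (n≤1+n _)) ⟩
    double (parity w)                    ≡⟨ cong double (parity-pred {w} z-even) ⟩
    v₂                                   ∎)
    where
    open ≡-Reasoning
    s = parity (X + b′)
    reindex : ∀ w → w + 4 * suc (suc (suc w))
                    ≡ suc (suc w + suc w + (suc (suc (suc w)) + suc (suc (suc w)) + suc (suc (suc w))))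
    reindex = solve-∀

odd-case : ∀ b′ {g} → (∀ p x₀ → Automaton.RowPeriodicFrom b′ p x₀ ⇔ HPeriodicFrom g p x₀) →
           suc b′ % 2 ≡ 1 → HPreperiodAndPeriod g b′ 2
odd-case b′ periods b-odd =
  PreperiodAndPeriod-⇔ periods (odd-rows b′ (parity-pred {b′} (n%2≡1⇒parity≡1ℙ (suc b′) b-odd)))

even-case : ∀ b′ {g} → (∀ p x₀ → Automaton.RowPeriodicFrom b′ p x₀ ⇔ HPeriodicFrom g p x₀) →
            suc b′ % 2 ≡ 0 → HPreperiodAndPeriod g (b′ ∸ 1) (4 * suc b′)
even-case zero    _       ()
even-case (suc z) periods b-even =
  PreperiodAndPeriod-⇔ periods (even-rows z (n%2≡0⇒parity≡0ℙ (suc (suc z)) b-even))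

mainTheorem8 : ∀ (b : ℕ) → 0 < b →
    (b % 2 ≡ 1 → HPreperiodAndPeriod (SG (L b 1 0 1 (b ∸ 1))) (b ∸ 1) 2)
    × (b % 2 ≡ 0 → HPreperiodAndPeriod (SG (L b 1 0 1 (b ∸ 1))) (b ∸ 2) (4 * b))
    × (b % 2 ≡ 1 → HPreperiodAndPeriod (SG (L b 1 0 1 (b + 1))) (b ∸ 1) 2)
    × (b % 2 ≡ 0 → HPreperiodAndPeriod (SG (L b 1 0 1 (b + 1))) (b ∸ 2) (4 * b))
mainTheorem8 zero ()
mainTheorem8 (suc b′) _ =
  odd-case b′ periods-minus , even-case b′ periods-minus , odd-case b′ periods-plus , even-case b′ periods-plus
  where open Automaton b′
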